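{- Suppose each bad event is dependent with at most $d$ bad events. Then for every positive integer $t$ there are at most $me(ed)^t$ collectible witness DAGs with $t$ nodes.
   Context: Setting: $\mathcal B$ is a set of $m$ bad events, each $B$ a Boolean function of the variables (from $X_1,\dots,X_n$) in $S_B\subseteq[n]$; $B\sim B'$ (dependent) iff $S_B\cap S_{B'}\ne\emptyset$, so each event is dependent with itself (counted in $d$). A witness DAG (WD) is a finite DAG whose vertices are labeled by bad events such that for distinct vertices $v,v'$ with labels $B,B'$: if $B\sim B'$ there is an edge between them (in one direction), and if $B\not\sim B'$ there is none. A WD whose sink nodes (vertices without outgoing edges) are labeled $B_1,\dots,B_s$ is collectible to $B$ if $B\sim B_j$ for all $j$, and collectible if it is collectible to some $B\in\mathcal B$. (WDs are counted up to isomorphism of labeled directed graphs.) -}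

module Defs where

open import Data.Nat using (ℕ; zero; suc; _+_; _*_; _^_; _≤_; _≥_)
open import Data.Integer using (+_)
open import Data.Rational as ℚ using (ℚ; _/_)
open import Data.Fin using (Fin)
open import Data.Fin.Subset using (Subset; _∈_)
open import Data.Bool using (Bool; true; false)
open import Data.List using (List; length)
open import Data.List.Relation.Unary.All using (All)
open import Data.List.Relation.Unary.Unique.Propositional using (Unique)
open import Data.Product using (Σ; ∃; _×_; _,_)
open import Data.Sum using (_⊎_)
open import Data.Empty using (⊥)
open import Relation.Nullary using (¬_)
open import Relation.Binary.PropositionalEquality using (_≡_)
open import Function.Bundles using (_↔_; Inverse)

record BadEvents : Set₁ where
  field
    n      : ℕ
    m      : ℕ
    Val    : Fin n → Set
    scope  : Fin m → Subset n
    event  : Fin m → ((i : Fin n) → Val i) → Bool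
    local  : ∀ B (x y : (i : Fin n) → Val i) →
             (∀ i → i ∈ scope B → x i ≡ y i) → event B x ≡ event B y

module _ (𝓑 : BadEvents) where
  open BadEvents 𝓑

  -- B ∼ B'  iff  S_B ∩ S_B' ≠ ∅   (reflexive whenever S_B ≠ ∅)
  _∼_ : Fin m → Fin m → Set
  B ∼ B' = ∃ λ i → i ∈ scope B × i ∈ scope B'

  -- every bad event is dependent with at most d bad events (itself included):
  -- any list of pairwise distinct events dependent with B has length ≤ d
  MaxDependency : ℕ → Set
  MaxDependency d = ∀ B (L : List (Fin m)) → Unique L → All (B ∼_) L → length L ≤ d

  data Path {t : ℕ} (E : Fin t → Fin t → Bool) : Fin t → Fin t → Set where
    edge : ∀ {u v} → E u v ≡ true → Path E u v
    step : ∀ {u w v} → E u w ≡ true → Path E w v → Path E u v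

  record WD (t : ℕ) : Set where
    field
      label   : Fin t → Fin m
      E       : Fin t → Fin t → Bool
      acyclic : ∀ v → ¬ Path E v v
      dep⇒edge   : ∀ u v → ¬ u ≡ v → label u ∼ label v → E u v ≡ true ⊎ E v u ≡ true
      indep⇒none : ∀ u v → ¬ u ≡ v → ¬ (label u ∼ label v) → E u v ≡ false

  Sink : ∀ {t} → WD t → Fin t → Set
  Sink G v = ∀ w → WD.E G v w ≡ false

  CollectibleTo : ∀ {t} → WD t → Fin m → Set
  CollectibleTo G B = ∀ v → Sink G v → B ∼ WD.label G v

  Collectible : ∀ {t} → WD t → Set
  Collectible G = ∃ λ B → CollectibleTo G B

  _≅_ : ∀ {t} → WD t → WD t → Set
  _≅_ {t} G H = Σ (Fin t ↔ Fin t) λ σ →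
      (∀ v → WD.label H (Inverse.to σ v) ≡ WD.label G v) ×
      (∀ u v → WD.E H (Inverse.to σ u) (Inverse.to σ v) ≡ WD.E G u v)

-- Euler's number via partial sums of the exponential series:
-- expTerm x j = x^j / j!,  expPartial x k = Σ_{j=0}^{k} x^j / j!

expTerm : ℕ → ℕ → ℚ
expTerm x zero    = ℚ.1ℚ
expTerm x (suc j) = expTerm x j ℚ.* ((+ x) / suc j)

expPartial : ℕ → ℕ → ℚ
expPartial x zero    = ℚ.1ℚ
expPartial x (suc k) = expPartial x k ℚ.+ expTerm x (suc k)

-- "N ≤ m · e · (e·d)^t" for natural N, i.e. N ≤ m d^t e^(t+1).
-- Since e^(t+1) = sup_k expPartial (t+1) k and e^(t+1) is irrational,
-- for natural N this is equivalent to N ≤ m d^t · expPartial (t+1) k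
-- for some k.
AtMostMeEdPow : ℕ → ℕ → ℕ → ℕ → Set
AtMostMeEdPow N m d t =
  ∃ λ k → (+ N / 1) ℚ.≤ ((+ (m * d ^ t)) / 1) ℚ.* expPartial (suc t) k

module Submission where

open import Defs
open import Data.Nat using (ℕ; _≥_)
open import Data.List using (List; length)
open import Data.List.Membership.Propositional using (_∈_)
open import Data.Product using (Σ; ∃; _×_)
open import Data.Product using (∃-syntax)

-- A WD on t vertices is determined up to isomorphism by the sequence of labels
-- obtained by repeatedly deleting a sink: conversely the sequence p₀ p₁ … rebuilds the WD
-- seqWD (vertex i points to the earlier vertices with dependent labels).  If the WD is
-- collectible to B, the first label is a neighbour of B, and after deleting a sink labelled
-- p the new sinks are old sinks or neighbours of p.  So the label sequences are produced by
-- Enum r P, which picks the next label from a candidate list P and then continues with the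
-- candidates after it plus the (at most d) neighbours of the chosen label.

open import Data.Nat using (zero; suc; _+_; _*_; _^_; _≤_; _!; z≤n; s≤s)
open import Data.Nat.Properties
  using (≤-refl; ≤-reflexive; m≤m+n; +-comm; +-assoc; *-comm; *-assoc; *-suc; *-identityʳ; *-distribʳ-+;
         +-mono-≤; +-monoˡ-≤; +-monoʳ-≤; *-monoʳ-≤; ^-monoˡ-≤; 1≤n!; m≤n⇒∃[o]m+o≡n; +-suc; n<1+n;
         module ≤-Reasoning)
open import Data.Nat.Tactic.RingSolver using (solve-∀)
open import Data.Integer as ℤ using (+_)
import Data.Integer.Properties as ℤP
open import Data.Rational as ℚ using (ℚ)
import Data.Rational.Properties as ℚP
open import Data.Rational.Unnormalised as ℚᵘ using (ℚᵘ; mkℚᵘ; *≡*; *≤*)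
import Data.Rational.Unnormalised.Properties as ℚᵘP
open import Algebra.Bundles using (CommutativeMonoid)
open import Algebra.Properties.CommutativeSemigroup
  (CommutativeMonoid.commutativeSemigroup ℚᵘP.*-1-commutativeMonoid) using (interchange)
open import Data.Fin as Fin using (Fin; zero; suc; punchIn; punchOut; toℕ)
open import Data.Fin.Properties
  using (_≟_; any?; all?; ¬∀⟶∃¬; pigeonhole; punchInᵢ≢i; punchIn-injective; punchIn-punchOut)
  renaming (<-trans to <ᶠ-trans; <-irrefl to <ᶠ-irrefl)
open import Data.Fin.Subset.Properties using (_∈?_)
import Data.Fin.Permutation as Perm
open import Data.Bool using (Bool; true; false)
open import Data.Bool.Properties using (¬-not) renaming (_≟_ to _≟ᵇ_)
open import Data.List using ([]; _∷_; _++_; map; concatMap; filter; allFin)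
open import Data.List.Properties using (length-++; length-map; length-tabulate)
open import Data.List.Membership.Propositional.Properties
  using (∈-filter⁺; ∈-allFin; ∈-++⁺ˡ; ∈-++⁺ʳ; ∈-map⁺; ∈-concat⁺′)
open import Data.List.Relation.Unary.All as All using (All; _∷_)
open import Data.List.Relation.Unary.All.Properties using (all-filter; ++⁺)
open import Data.List.Relation.Unary.Any using (here; there)
import Data.List.Relation.Unary.Unique.Propositional.Properties as Unique
open import Data.Vec as Vec using (Vec; []; _∷_; lookup)
open import Data.Product using (_,_; proj₁; proj₂)
open import Data.Sum using (_⊎_; inj₁; inj₂)
open import Data.Empty using (⊥-elim)
open import Function using (_∘_)
open import Function.Bundles using (Inverse)
open import Function.Construct.Identity using (↔-id)
open import Relation.Nullary using (¬_; Dec; yes; no; does; _×-dec_)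
open import Relation.Nullary.Decidable using (dec-true; dec-false)
open import Relation.Nullary.Negation using (contradiction)
open import Relation.Binary.PropositionalEquality
  using (_≡_; refl; sym; trans; cong; cong₂; subst; module ≡-Reasoning)

-- The first two terms of the binomial expansion of (n + 1)^(k + 1).
bernoulli : ∀ n k → n ^ suc k + suc k * n ^ k ≤ suc n ^ suc k
bernoulli n zero = ≤-reflexive (+-comm (n * 1) 1)
bernoulli n (suc k) = begin
    n ^ suc (suc k) + suc (suc k) * n ^ suc k
  ≤⟨ m≤m+n _ (suc k * n ^ k) ⟩
    n ^ suc (suc k) + suc (suc k) * n ^ suc k + suc k * n ^ k
  ≡⟨ expand n (n ^ k) k ⟩
    suc n * (n ^ suc k + suc k * n ^ k)
  ≤⟨ *-monoʳ-≤ (suc n) (bernoulli n k) ⟩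
    suc n ^ suc (suc k)
  ∎
  where
  open ≤-Reasoning
  expand : ∀ n a k → n * (n * a) + suc (suc k) * (n * a) + suc k * a ≡ suc n * (n * a + suc k * a)
  expand = solve-∀

^-distrib-* : ∀ a b k → (a * b) ^ k ≡ a ^ k * b ^ k
^-distrib-* a b zero    = refl
^-distrib-* a b (suc k) rewrite ^-distrib-* a b k = interchangeℕ a b (a ^ k) (b ^ k)
  where
  interchangeℕ : ∀ a b x y → a * b * (x * y) ≡ a * x * (b * y)
  interchangeℕ = solve-∀

length-concatMap-≤ : ∀ {A B : Set} (f : A → List B) {k c} → (∀ x → length (f x) * k ≤ c) →
                     ∀ xs → length (concatMap f xs) * k ≤ length xs * c
length-concatMap-≤ f         bound []       = z≤n
length-concatMap-≤ f {k} {c} bound (x ∷ xs) = begin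
    length (f x ++ concatMap f xs) * k
  ≡⟨ cong (_* k) (length-++ (f x)) ⟩
    (length (f x) + length (concatMap f xs)) * k
  ≡⟨ *-distribʳ-+ k (length (f x)) _ ⟩
    length (f x) * k + length (concatMap f xs) * k
  ≤⟨ +-mono-≤ (bound x) (length-concatMap-≤ f bound xs) ⟩
    c + length xs * c
  ∎
  where open ≤-Reasoning

expTerm-nonNeg : ∀ x j → ℚ.NonNegative (expTerm x j)
expTerm-nonNeg x zero    = _
expTerm-nonNeg x (suc j) =
  ℚP.nonNeg*nonNeg⇒nonNeg (expTerm x j) {{expTerm-nonNeg x j}} (+ x ℚ./ suc j)
    {{ℚP.normalize-nonNeg x (suc j)}}

expPartial-nonNeg : ∀ x k → ℚ.NonNegative (expPartial x k)
expPartial-nonNeg x zero    = _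
expPartial-nonNeg x (suc k) =
  ℚP.nonNeg+nonNeg⇒nonNeg (expPartial x k) {{expPartial-nonNeg x k}} (expTerm x (suc k))
    {{expTerm-nonNeg x (suc k)}}

expTerm≤expPartial : ∀ x k → expTerm x k ℚ.≤ expPartial x k
expTerm≤expPartial x zero    = ℚP.≤-refl
expTerm≤expPartial x (suc k) = begin
    expTerm x (suc k)
  ≡⟨ sym (ℚP.+-identityˡ (expTerm x (suc k))) ⟩
    ℚ.0ℚ ℚ.+ expTerm x (suc k)
  ≤⟨ ℚP.+-monoˡ-≤ (expTerm x (suc k)) (ℚP.nonNegative⁻¹ (expPartial x k) {{expPartial-nonNeg x k}}) ⟩
    expPartial x k ℚ.+ expTerm x (suc k)
  ∎
  where open ℚP.≤-Reasoning

ι : ℕ → ℚᵘ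
ι n = + n ℚᵘ./ 1

ι-* : ∀ a b → ι (a * b) ℚᵘ.≃ ι a ℚᵘ.* ι b
ι-* a b = ℚᵘP.≃-reflexive (cong (λ z → mkℚᵘ z 0) (ℤP.pos-* a b))

ι-mono : ∀ {a b} → a ≤ b → ι a ℚᵘ.≤ ι b
ι-mono a≤b = *≤* (ℤP.*-monoʳ-≤-nonNeg (+ 1) (ℤ.+≤+ a≤b))

ratio-cancel : ∀ x j → ℚ.toℚᵘ (+ x ℚ./ suc j) ℚᵘ.* ι (suc j) ℚᵘ.≃ ι x
ratio-cancel x j = ℚᵘP.≃-trans (ℚᵘP.*-congʳ (ℚP.toℚᵘ-fromℚᵘ (mkℚᵘ (+ x) j))) (*≡* (begin
    (+ x ℤ.* + suc j) ℤ.* + 1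
  ≡⟨ ℤP.*-identityʳ (+ x ℤ.* + suc j) ⟩
    + x ℤ.* + suc j
  ≡⟨ cong (λ n → + x ℤ.* + n) (sym (*-identityʳ (suc j))) ⟩
    + x ℤ.* + (suc j * 1)
  ∎))
  where open ≡-Reasoning

expTerm-scaled : ∀ x j → ℚ.toℚᵘ (expTerm x j) ℚᵘ.* ι (j !) ℚᵘ.≃ ι (x ^ j)
expTerm-scaled x zero    = ℚᵘP.*-identityʳ (ι 1)
expTerm-scaled x (suc j) = begin-equality
    ℚ.toℚᵘ (expTerm x j ℚ.* (+ x ℚ./ suc j)) ℚᵘ.* ι (suc j * j !)
  ≃⟨ ℚᵘP.*-cong (ℚP.toℚᵘ-homo-* (expTerm x j) (+ x ℚ./ suc j)) (ι-* (suc j) (j !)) ⟩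
    (T ℚᵘ.* R) ℚᵘ.* (ι (suc j) ℚᵘ.* ι (j !))
  ≃⟨ ℚᵘP.*-congˡ {T ℚᵘ.* R} (ℚᵘP.*-comm (ι (suc j)) (ι (j !))) ⟩
    (T ℚᵘ.* R) ℚᵘ.* (ι (j !) ℚᵘ.* ι (suc j))
  ≃⟨ interchange T R (ι (j !)) (ι (suc j)) ⟩
    (T ℚᵘ.* ι (j !)) ℚᵘ.* (R ℚᵘ.* ι (suc j))
  ≃⟨ ℚᵘP.*-cong (expTerm-scaled x j) (ratio-cancel x j) ⟩
    ι (x ^ j) ℚᵘ.* ι x
  ≃⟨ ℚᵘP.≃-sym (ι-* (x ^ j) x) ⟩
    ι (x ^ j * x)
  ≡⟨ cong ι (*-comm (x ^ j) x) ⟩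
    ι (x ^ suc j)
  ∎
  where
  open ℚᵘP.≤-Reasoning
  T = ℚ.toℚᵘ (expTerm x j)
  R = ℚ.toℚᵘ (+ x ℚ./ suc j)

expPartial-bound : ∀ N K x j → N * j ! ≤ K * x ^ j →
                   (+ N ℚ./ 1) ℚ.≤ (+ K ℚ./ 1) ℚ.* expPartial x j
expPartial-bound N K x j bound = ℚP.toℚᵘ-cancel-≤ (begin
    ℚ.toℚᵘ (+ N ℚ./ 1)
  ≃⟨ ℚP.toℚᵘ-fromℚᵘ (ι N) ⟩
    ι N
  ≤⟨ ℚᵘP.*-cancelʳ-≤-pos (ι (j !)) {{ℤ.positive (ℤ.+<+ (1≤n! j))}} scaled ⟩
    ι K ℚᵘ.* T
  ≤⟨ ℚᵘP.*-monoʳ-≤-nonNeg (ι K) (ℚP.toℚᵘ-mono-≤ (expTerm≤expPartial x j)) ⟩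
    ι K ℚᵘ.* ℚ.toℚᵘ (expPartial x j)
  ≃⟨ ℚᵘP.*-congʳ (ℚᵘP.≃-sym (ℚP.toℚᵘ-fromℚᵘ (ι K))) ⟩
    ℚ.toℚᵘ (+ K ℚ./ 1) ℚᵘ.* ℚ.toℚᵘ (expPartial x j)
  ≃⟨ ℚᵘP.≃-sym (ℚP.toℚᵘ-homo-* (+ K ℚ./ 1) (expPartial x j)) ⟩
    ℚ.toℚᵘ ((+ K ℚ./ 1) ℚ.* expPartial x j)
  ∎)
  where
  open ℚᵘP.≤-Reasoning
  T = ℚ.toℚᵘ (expTerm x j)
  scaled : ι N ℚᵘ.* ι (j !) ℚᵘ.≤ (ι K ℚᵘ.* T) ℚᵘ.* ι (j !)
  scaled = begin
      ι N ℚᵘ.* ι (j !)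
    ≃⟨ ℚᵘP.≃-sym (ι-* N (j !)) ⟩
      ι (N * j !)
    ≤⟨ ι-mono bound ⟩
      ι (K * x ^ j)
    ≃⟨ ι-* K (x ^ j) ⟩
      ι K ℚᵘ.* ι (x ^ j)
    ≃⟨ ℚᵘP.*-congˡ {ι K} (ℚᵘP.≃-sym (expTerm-scaled x j)) ⟩
      ι K ℚᵘ.* (T ℚᵘ.* ι (j !))
    ≃⟨ ℚᵘP.≃-sym (ℚᵘP.*-assoc (ι K) T (ι (j !))) ⟩
      (ι K ℚᵘ.* T) ℚᵘ.* ι (j !)
    ∎

module WitnessDAGs (𝓑 : BadEvents) where
  open BadEvents 𝓑

  _~_ : Fin m → Fin m → Set
  _~_ = _∼_ 𝓑

  _~?_ : ∀ B B' → Dec (B ~ B')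
  B ~? B' = any? (λ i → (i ∈? scope B) ×-dec (i ∈? scope B'))

  ~-sym : ∀ {B B'} → B ~ B' → B' ~ B
  ~-sym (i , i∈B , i∈B') = i , i∈B' , i∈B

  SelfDependent : Fin m → Set
  SelfDependent B = B ~ B

  ~-selfʳ : ∀ {B B'} → B ~ B' → SelfDependent B'
  ~-selfʳ (i , _ , i∈B') = i , i∈B' , i∈B'

  neighbours : Fin m → List (Fin m)
  neighbours B = filter (B ~?_) (allFin m)

  ∈-neighbours : ∀ {B B'} → B ~ B' → B' ∈ neighbours B
  ∈-neighbours {B} dep = ∈-filter⁺ (B ~?_) (∈-allFin _) dep

  neighbours-selfDependent : ∀ B → All SelfDependent (neighbours B)
  neighbours-selfDependent B = All.map ~-selfʳ (all-filter (B ~?_) (allFin m))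

  neighbours-length : ∀ {d} → MaxDependency 𝓑 d → ∀ B → length (neighbours B) ≤ d
  neighbours-length maxDep B =
    maxDep B (neighbours B) (Unique.filter⁺ (B ~?_) (Unique.allFin⁺ m)) (all-filter (B ~?_) (allFin m))

  -- The WD of a label sequence p₀ p₁ … p_{t-1}: vertex i has an edge to each earlier
  -- vertex j < i whose label depends on its own.  Edges decrease the index, so it is acyclic.
  seqEdge : ∀ {t} → Vec (Fin m) t → Fin t → Fin t → Bool
  seqEdge (p ∷ ℓ) zero    j       = false
  seqEdge (p ∷ ℓ) (suc i) zero    = does (lookup ℓ i ~? p)
  seqEdge (p ∷ ℓ) (suc i) (suc j) = seqEdge ℓ i j

  seqEdge-decreasing : ∀ {t} (ℓ : Vec (Fin m) t) i j → seqEdge ℓ i j ≡ true → j Fin.< i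
  seqEdge-decreasing (p ∷ ℓ) (suc i) zero    _ = s≤s z≤n
  seqEdge-decreasing (p ∷ ℓ) (suc i) (suc j) e = s≤s (seqEdge-decreasing ℓ i j e)

  seqPath-decreasing : ∀ {t} (ℓ : Vec (Fin m) t) {i j} → Path 𝓑 (seqEdge ℓ) i j → j Fin.< i
  seqPath-decreasing ℓ (edge e)   = seqEdge-decreasing ℓ _ _ e
  seqPath-decreasing ℓ (step e p) = <ᶠ-trans (seqPath-decreasing ℓ p) (seqEdge-decreasing ℓ _ _ e)

  seqEdge-dep : ∀ {t} (ℓ : Vec (Fin m) t) i j → ¬ i ≡ j → lookup ℓ i ~ lookup ℓ j →
                seqEdge ℓ i j ≡ true ⊎ seqEdge ℓ j i ≡ true
  seqEdge-dep (p ∷ ℓ) zero    zero    i≢j _   = contradiction refl i≢j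
  seqEdge-dep (p ∷ ℓ) zero    (suc j) _   dep = inj₂ (dec-true (_ ~? _) (~-sym dep))
  seqEdge-dep (p ∷ ℓ) (suc i) zero    _   dep = inj₁ (dec-true (_ ~? _) dep)
  seqEdge-dep (p ∷ ℓ) (suc i) (suc j) i≢j dep = seqEdge-dep ℓ i j (i≢j ∘ cong suc) dep

  seqEdge-indep : ∀ {t} (ℓ : Vec (Fin m) t) i j → ¬ (lookup ℓ i ~ lookup ℓ j) → seqEdge ℓ i j ≡ false
  seqEdge-indep (p ∷ ℓ) zero    j       _     = refl
  seqEdge-indep (p ∷ ℓ) (suc i) zero    indep = dec-false (_ ~? _) indep
  seqEdge-indep (p ∷ ℓ) (suc i) (suc j) indep = seqEdge-indep ℓ i j indep

  seqWD : ∀ {t} → Vec (Fin m) t → WD 𝓑 t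
  seqWD ℓ = record
    { label      = lookup ℓ
    ; E          = seqEdge ℓ
    ; acyclic    = λ v cyc → <ᶠ-irrefl refl (seqPath-decreasing ℓ cyc)
    ; dep⇒edge   = seqEdge-dep ℓ
    ; indep⇒none = λ u v _ → seqEdge-indep ℓ u v
    }

  module _ {r} (G : WD 𝓑 (suc r)) (v : Fin (suc r)) where
    private module G = WD G

    removedEdge : Fin r → Fin r → Bool
    removedEdge i j = G.E (punchIn v i) (punchIn v j)

    removedPath : ∀ {i j} → Path 𝓑 removedEdge i j → Path 𝓑 G.E (punchIn v i) (punchIn v j)
    removedPath (edge e)   = edge e
    removedPath (step e p) = step e (removedPath p)

    removeVertex : WD 𝓑 r
    removeVertex = record
      { label      = G.label ∘ punchIn v
      ; E          = removedEdge
      ; acyclic    = λ i cyc → G.acyclic _ (removedPath cyc)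
      ; dep⇒edge   = λ i j i≢j → G.dep⇒edge _ _ (i≢j ∘ punchIn-injective v i j)
      ; indep⇒none = λ i j i≢j → G.indep⇒none _ _ (i≢j ∘ punchIn-injective v i j)
      }

  vertex-split : ∀ {r} (v u : Fin (suc r)) → u ≡ v ⊎ ∃ λ k → u ≡ punchIn v k
  vertex-split v u with u ≟ v
  ... | yes u≡v = inj₁ u≡v
  ... | no  u≢v = inj₂ (punchOut (u≢v ∘ sym) , sym (punchIn-punchOut (u≢v ∘ sym)))

  -- If every vertex of a finite digraph has an out-neighbour, iterating a choice of
  -- out-neighbours from vertex 0 must revisit a vertex (pigeonhole), closing a cycle.
  cycle-of-successors : ∀ {r} (E : Fin (suc r) → Fin (suc r) → Bool) →
                        (∀ u → ∃ λ w → E u w ≡ true) → ∃ λ y → Path 𝓑 E y y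
  cycle-of-successors {r} E succ = y , subst (Path 𝓑 E y) returns (walk-path o y)
    where
    next : Fin (suc r) → Fin (suc r)
    next = proj₁ ∘ succ

    walk : ℕ → Fin (suc r) → Fin (suc r)
    walk zero    u = u
    walk (suc k) u = walk k (next u)

    walk-path : ∀ k u → Path 𝓑 E u (walk (suc k) u)
    walk-path zero    u = edge (proj₂ (succ u))
    walk-path (suc k) u = step (proj₂ (succ u)) (walk-path k (next u))

    walk-+ : ∀ a k u → walk (a + k) u ≡ walk k (walk a u)
    walk-+ zero    k u = refl
    walk-+ (suc a) k u = walk-+ a k (next u)

    repeat = pigeonhole (n<1+n (suc r)) (λ i → walk (toℕ i) zero)
    i = proj₁ repeat
    j = proj₁ (proj₂ repeat)
    i<j : suc (toℕ i) ≤ toℕ j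
    i<j = proj₁ (proj₂ (proj₂ repeat))
    same : walk (toℕ i) zero ≡ walk (toℕ j) zero
    same = proj₂ (proj₂ (proj₂ repeat))
    o = proj₁ (m≤n⇒∃[o]m+o≡n i<j)

    y = walk (toℕ i) zero
    returns : walk (suc o) y ≡ y
    returns = begin
        walk (suc o) y                  ≡⟨ walk-+ (toℕ i) (suc o) zero ⟨
        walk (toℕ i + suc o) zero       ≡⟨ cong (λ n → walk n zero) (+-suc (toℕ i) o) ⟩
        walk (suc (toℕ i) + o) zero     ≡⟨ cong (λ n → walk n zero) (proj₂ (m≤n⇒∃[o]m+o≡n i<j)) ⟩
        walk (toℕ j) zero               ≡⟨ same ⟨
        y                               ∎
      where open ≡-Reasoning

  Sink? : ∀ {t} (G : WD 𝓑 t) v → Dec (Sink 𝓑 G v)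
  Sink? G v = all? (λ w → WD.E G v w ≟ᵇ false)

  -- A WD with at least one vertex has a sink, since otherwise it would contain a cycle.
  sink-exists : ∀ {r} (G : WD 𝓑 (suc r)) → ∃ (Sink 𝓑 G)
  sink-exists G with any? (Sink? G)
  ... | yes sink = sink
  ... | no  none = ⊥-elim (WD.acyclic G _ (proj₂ (cycle-of-successors (WD.E G) successor)))
    where
    successor : ∀ u → ∃ λ w → WD.E G u w ≡ true
    successor u with ¬∀⟶∃¬ _ _ (λ w → WD.E G u w ≟ᵇ false) (λ sink → none (u , sink))
    ... | w , not-false = w , ¬-not not-false

  insert-self : ∀ {a b} (v : Fin (suc a)) (j : Fin (suc b)) π → Inverse.to (Perm.insert v j π) v ≡ j
  insert-self v j π with v ≟ v
  ... | yes _   = refl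
  ... | no  v≢v = contradiction refl v≢v

  -- If v is a sink of G labelled p and G without v is isomorphic to seqWD ℓ, then G is
  -- isomorphic to seqWD (p ∷ ℓ): send v to 0 and the remaining vertices as before.
  extend-iso : ∀ {r} (G : WD 𝓑 (suc r)) v {p} {ℓ : Vec (Fin m) r} →
               Sink 𝓑 G v → WD.label G v ≡ p → _≅_ 𝓑 (removeVertex G v) (seqWD ℓ) →
               _≅_ 𝓑 G (seqWD (p ∷ ℓ))
  extend-iso G v {p} {ℓ} sink refl (σ , σ-label , σ-edge) = τ , τ-label , τ-edge
    where
    module G = WD G
    τ = Perm.insert v zero σ
    τ-v : Inverse.to τ v ≡ zero
    τ-v = insert-self v zero σ
    τ-punchIn : ∀ k → Inverse.to τ (punchIn v k) ≡ suc (Inverse.to σ k)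
    τ-punchIn k = Perm.insert-punchIn v zero σ k

    τ-label : ∀ u → lookup (p ∷ ℓ) (Inverse.to τ u) ≡ G.label u
    τ-label u with vertex-split v u
    ... | inj₁ refl       rewrite τ-v         = refl
    ... | inj₂ (k , refl) rewrite τ-punchIn k = σ-label k

    edge-into-v : ∀ k → does (G.label (punchIn v k) ~? p) ≡ G.E (punchIn v k) v
    edge-into-v k with G.label (punchIn v k) ~? p
    ... | no  indep = sym (G.indep⇒none _ _ (punchInᵢ≢i v k) indep)
    ... | yes dep with G.dep⇒edge _ _ (punchInᵢ≢i v k) dep
    ...   | inj₁ into-v = sym into-v
    ...   | inj₂ out-of-v = contradiction (trans (sym out-of-v) (sink _)) λ ()

    τ-edge : ∀ u w → seqEdge (p ∷ ℓ) (Inverse.to τ u) (Inverse.to τ w) ≡ G.E u w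
    τ-edge u w with vertex-split v u | vertex-split v w
    ... | inj₁ refl       | _               rewrite τ-v = sym (sink w)
    ... | inj₂ (k , refl) | inj₁ refl       rewrite τ-punchIn k | τ-v | σ-label k = edge-into-v k
    ... | inj₂ (k , refl) | inj₂ (l , refl) rewrite τ-punchIn k | τ-punchIn l = σ-edge k l

  SinksIn : ∀ {t} → WD 𝓑 t → List (Fin m) → Set
  SinksIn G P = ∀ v → Sink 𝓑 G v → WD.label G v ∈ P

  -- Deleting a sink v labelled p (with p ∼ p): a sink of the rest either had v as an
  -- out-neighbour (so its label depends on p) or was already a sink of G; in the latter
  -- case its label is not p, as two sinks with dependent labels would be joined by an edge.
  removal-sinks : ∀ {r} (G : WD 𝓑 (suc r)) v {p P} → SelfDependent p → Sink 𝓑 G v →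
                  WD.label G v ≡ p → SinksIn G (p ∷ P) → SinksIn (removeVertex G v) (P ++ neighbours p)
  removal-sinks G v {p} {P} p~p sink refl sinksIn k sink-k with WD.E G (punchIn v k) v in into-v
  ... | true with WD.label G (punchIn v k) ~? p
  ...   | yes dep   = ∈-++⁺ʳ P (∈-neighbours (~-sym dep))
  ...   | no  indep = contradiction (trans (sym into-v) (WD.indep⇒none G _ _ (punchInᵢ≢i v k) indep)) λ ()
  removal-sinks G v {p} {P} p~p sink refl sinksIn k sink-k | false with sinksIn (punchIn v k) old-sink
    where
    old-sink : Sink 𝓑 G (punchIn v k)
    old-sink w with vertex-split v w
    ... | inj₁ refl       = into-v
    ... | inj₂ (l , refl) = sink-k l
  ... | there k∈P = ∈-++⁺ˡ k∈P
  ... | here same-label with WD.dep⇒edge G _ _ (punchInᵢ≢i v k) (subst (_~ p) (sym same-label) p~p)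
  ...   | inj₁ into-v′ = contradiction (trans (sym into-v) into-v′) λ ()
  ...   | inj₂ out-of-v = contradiction (trans (sym out-of-v) (sink _)) λ ()

  -- Label sequences of length r built by repeatedly peeling a sink: the first label is
  -- chosen from the candidate list P (the choice of p ∈ P discards the candidates before
  -- it), and the rest is built from the remaining candidates together with the neighbours of p.
  Enum : (r : ℕ) → List (Fin m) → List (Vec (Fin m) r)
  Enum zero    P       = [] ∷ []
  Enum (suc r) []      = []
  Enum (suc r) (p ∷ P) = Enum (suc r) P ++ map (p ∷_) (Enum r (P ++ neighbours p))

  EnumComplete : ℕ → List (Fin m) → Set
  EnumComplete r P = All SelfDependent P → (G : WD 𝓑 r) → SinksIn G P →
                     ∃ λ ℓ → ℓ ∈ Enum r P × _≅_ 𝓑 G (seqWD ℓ)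

  enum-peel : ∀ {r p P} → EnumComplete r (P ++ neighbours p) → SelfDependent p → All SelfDependent P →
              (G : WD 𝓑 (suc r)) → SinksIn G (p ∷ P) → ∀ v → Sink 𝓑 G v → WD.label G v ≡ p →
              ∃ λ ℓ → ℓ ∈ Enum (suc r) (p ∷ P) × _≅_ 𝓑 G (seqWD ℓ)
  enum-peel {r} {p} {P} complete p~p selfDep G sinksIn v sink label-p
    with complete (++⁺ selfDep (neighbours-selfDependent p)) (removeVertex G v)
                  (removal-sinks G v p~p sink label-p sinksIn)
  ... | ℓ , ℓ∈ , iso = p ∷ ℓ , ∈-++⁺ʳ (Enum (suc r) P) (∈-map⁺ (p ∷_) ℓ∈) , extend-iso G v sink label-p iso

  enum-skip : ∀ {r p P} → EnumComplete (suc r) P → All SelfDependent P →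
              (G : WD 𝓑 (suc r)) → SinksIn G (p ∷ P) → ¬ (∃ λ v → Sink 𝓑 G v × WD.label G v ≡ p) →
              ∃ λ ℓ → ℓ ∈ Enum (suc r) (p ∷ P) × _≅_ 𝓑 G (seqWD ℓ)
  enum-skip complete selfDep G sinksIn no-p-sink with complete selfDep G sinksInP
    where
    sinksInP : SinksIn G _
    sinksInP v sink with sinksIn v sink
    ... | here label-p = ⊥-elim (no-p-sink (v , sink , label-p))
    ... | there v∈P    = v∈P
  ... | ℓ , ℓ∈ , iso = ℓ , ∈-++⁺ˡ ℓ∈ , iso

  enum-step : ∀ {r p P} → EnumComplete r (P ++ neighbours p) → EnumComplete (suc r) P →
              EnumComplete (suc r) (p ∷ P)
  enum-step {p = p} complete-peel complete-skip (p~p ∷ selfDep) G sinksIn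
    with any? (λ v → Sink? G v ×-dec (WD.label G v ≟ p))
  ... | yes (v , sink , label-p) = enum-peel complete-peel p~p selfDep G sinksIn v sink label-p
  ... | no no-p-sink             = enum-skip complete-skip selfDep G sinksIn no-p-sink

  enum-complete : ∀ r P → EnumComplete r P
  enum-complete zero    P       _ G _ = [] , here refl , ↔-id (Fin 0) , (λ ()) , (λ ())
  enum-complete (suc r) []      _ G sinksIn with sinksIn _ (proj₂ (sink-exists G))
  ... | ()
  enum-complete (suc r) (p ∷ P) =
    enum-step (enum-complete r (P ++ neighbours p)) (enum-complete (suc r) P)

  candidates : (t : ℕ) → List (WD 𝓑 t)
  candidates t = concatMap (λ B → map seqWD (Enum t (neighbours B))) (allFin m)

  -- Every collectible WD is isomorphic to a candidate: if it is collectible to B, its sinks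
  -- are labelled by neighbours of B.
  candidates-cover : ∀ t (G : WD 𝓑 t) → Collectible 𝓑 G → ∃ λ H → H ∈ candidates t × _≅_ 𝓑 G H
  candidates-cover t G (B , collectible)
    with enum-complete t (neighbours B) (neighbours-selfDependent B) G (λ v sink → ∈-neighbours (collectible v sink))
  ... | ℓ , ℓ∈ , iso = seqWD ℓ , ∈-concat⁺′ (∈-map⁺ seqWD ℓ∈) (∈-map⁺ _ (∈-allFin B)) , iso

  module Counting {d} (maxDep : MaxDependency 𝓑 d) where

    -- With N = |P| + d (r + 1), the two parts of
    -- Enum (r + 1) (p ∷ P) contribute at most N^(r+1) and (r + 1) N^r (the new candidate
    -- list P ++ neighbours p has at most |P| + d elements), and Bernoulli's inequality
    -- bounds the sum by (N + 1)^(r+1).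
    enum-count : ∀ r P → length (Enum r P) * r ! ≤ (length P + d * r) ^ r
    enum-count zero    P       = ≤-refl
    enum-count (suc r) []      = z≤n
    enum-count (suc r) (p ∷ P) = begin
        length (Enum (suc r) P ++ map (p Vec.∷_) (Enum r Q)) * suc r !
      ≡⟨ cong (_* suc r !) (length-++ (Enum (suc r) P)) ⟩
        (length (Enum (suc r) P) + length (map (p Vec.∷_) (Enum r Q))) * suc r !
      ≡⟨ cong (λ n → (length (Enum (suc r) P) + n) * suc r !) (length-map (p Vec.∷_) (Enum r Q)) ⟩
        (length (Enum (suc r) P) + length (Enum r Q)) * suc r !
      ≡⟨ distribute (length (Enum (suc r) P)) (length (Enum r Q)) r (r !) ⟩
        length (Enum (suc r) P) * suc r ! + suc r * (length (Enum r Q) * r !)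
      ≤⟨ +-mono-≤ (enum-count (suc r) P) (*-monoʳ-≤ (suc r) (enum-count r Q)) ⟩
        N ^ suc r + suc r * (length Q + d * r) ^ r
      ≤⟨ +-monoʳ-≤ (N ^ suc r) (*-monoʳ-≤ (suc r) (^-monoˡ-≤ r Q-size)) ⟩
        N ^ suc r + suc r * N ^ r
      ≤⟨ bernoulli N r ⟩
        suc N ^ suc r
      ∎
      where
      open ≤-Reasoning
      Q = P ++ neighbours p
      N = length P + d * suc r
      distribute : ∀ a b r f → (a + b) * (suc r * f) ≡ a * (suc r * f) + suc r * (b * f)
      distribute = solve-∀
      Q-size : length Q + d * r ≤ N
      Q-size = begin
          length (P ++ neighbours p) + d * r
        ≡⟨ cong (_+ d * r) (length-++ P) ⟩
          length P + length (neighbours p) + d * r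
        ≤⟨ +-monoˡ-≤ (d * r) (+-monoʳ-≤ (length P) (neighbours-length maxDep p)) ⟩
          length P + d + d * r
        ≡⟨ +-assoc (length P) d (d * r) ⟩
          length P + (d + d * r)
        ≡⟨ cong (λ n → length P + n) (sym (*-suc d r)) ⟩
          N
        ∎

    candidates-count : ∀ t → length (candidates t) * t ! ≤ (m * d ^ t) * suc t ^ t
    candidates-count t = begin
        length (candidates t) * t !
      ≤⟨ length-concatMap-≤ (λ B → map seqWD (Enum t (neighbours B))) per-event (allFin m) ⟩
        length (allFin m) * (d * suc t) ^ t
      ≡⟨ cong₂ _*_ (length-tabulate {n = m} (λ i → i)) (^-distrib-* d (suc t) t) ⟩
        m * (d ^ t * suc t ^ t)
      ≡⟨ sym (*-assoc m (d ^ t) (suc t ^ t)) ⟩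
        (m * d ^ t) * suc t ^ t
      ∎
      where
      open ≤-Reasoning
      per-event : ∀ B → length (map seqWD (Enum t (neighbours B))) * t ! ≤ (d * suc t) ^ t
      per-event B = begin
          length (map seqWD (Enum t (neighbours B))) * t !
        ≡⟨ cong (_* t !) (length-map seqWD (Enum t (neighbours B))) ⟩
          length (Enum t (neighbours B)) * t !
        ≤⟨ enum-count t (neighbours B) ⟩
          (length (neighbours B) + d * t) ^ t
        ≤⟨ ^-monoˡ-≤ t (+-monoˡ-≤ (d * t) (neighbours-length maxDep B)) ⟩
          (d + d * t) ^ t
        ≡⟨ cong (_^ t) (sym (*-suc d t)) ⟩
          (d * suc t) ^ t
        ∎

mainTheorem18 : (𝓑 : BadEvents) (d : ℕ) → MaxDependency 𝓑 d →
    (t : ℕ) → t ≥ 1 →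
    ∃[ L ] (AtMostMeEdPow (length L) (BadEvents.m 𝓑) d t ×
    ((G : WD 𝓑 t) → Collectible 𝓑 G → ∃[ H ] (H ∈ L × _≅_ 𝓑 G H)))
-- The candidates cover all collectible WDs, and their number N satisfies
-- N · t! ≤ m d^t (t + 1)^t, i.e. N ≤ m d^t · (t + 1)^t / t! ≤ m d^t · e^(t+1).
mainTheorem18 𝓑 d maxDep t _ =
    candidates t
  , (t , expPartial-bound (length (candidates t)) (m * d ^ t) (suc t) t (candidates-count t))
  , candidates-cover t
  where
  open BadEvents 𝓑 using (m)
  open WitnessDAGs 𝓑
  open Counting maxDep
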